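{- Let $G$ be a finite bipartite graph with bipartition $(X,Y)$. Suppose that $a,b,c,d\in X$, with $a,b,c$ pairwise distinct and $c\neq d$, satisfy $(a,b)\,\Gamma\,(c,d)$, and that one of $(a,c)$ and $(c,b)$ is relevant. Then $(a,c)\,\Gamma\,(a,b)$ or $(c,b)\,\Gamma\,(a,b)$.
   Context: Two edges $xy,x'y'$ ($x,x'\in X$, $y,y'\in Y$) are independent if $x\ne x'$, $y\ne y'$, $xy'\notin E(G)$ and $x'y\notin E(G)$. Two walks $a_1\dots a_k$, $b_1\dots b_k$ with $a_1,b_1$ in the same part are congruent if for each $i$ the edges $a_ia_{i+1}$ and $b_ib_{i+1}$ are independent. Let $\mathcal F$ be the set of ordered pairs of distinct vertices both in $X$ or both in $Y$. For $(a,b),(f,g)\in\mathcal F$, $(a,b)\,\Gamma\,(f,g)$ means there exist congruent walks from $a$ to $f$ and from $b$ to $g$. The implication class of $(a,b)$ is the set of $(f,g)\in\mathcal F$ with $(a,b)\,\Gamma\,(f,g)$; $(a,b)$ is relevant if its implication class contains at least two pairs. -}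

module Defs where

open import Data.Nat using (ℕ)
open import Data.Fin using (Fin)
open import Data.Bool using (Bool; true; false; T)
open import Data.Sum using (_⊎_; inj₁; inj₂)
open import Data.Product using (_×_; _,_; Σ; ∃)
open import Data.Unit using (⊤)
open import Data.Empty using (⊥)
open import Relation.Binary.PropositionalEquality using (_≡_; _≢_)
open import Relation.Nullary using (¬_)

-- A finite bipartite graph with parts X = Fin m and Y = Fin n is given by
-- its bipartite adjacency relation  E : Fin m → Fin n → Bool.
-- The vertex set is X ⊎ Y.
Vertex : ℕ → ℕ → Set
Vertex m n = Fin m ⊎ Fin n

module Graph {m n : ℕ} (E : Fin m → Fin n → Bool) where

  V : Set
  V = Vertex m n

  Adj : V → V → Set
  Adj (inj₁ x) (inj₂ y) = T (E x y)
  Adj (inj₂ y) (inj₁ x) = T (E x y)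
  Adj (inj₁ _) (inj₁ _) = ⊥
  Adj (inj₂ _) (inj₂ _) = ⊥

  ends : (u v : V) → Adj u v → Fin m × Fin n
  ends (inj₁ x) (inj₂ y) _ = x , y
  ends (inj₂ y) (inj₁ x) _ = x , y

  Independent : Fin m × Fin n → Fin m × Fin n → Set
  Independent (x , y) (x' , y') =
    x ≢ x' × y ≢ y' × ¬ T (E x y') × ¬ T (E x' y)

  data Walk : V → V → Set where
    [_]  : (u : V) → Walk u u
    _∷⟨_⟩_ : (u : V) {v w : V} → Adj u v → Walk v w → Walk u w

  Congruent : {a f b g : V} → Walk a f → Walk b g → Set
  Congruent [ _ ] [ _ ] = ⊤
  Congruent [ _ ] (_ ∷⟨ _ ⟩ _) = ⊥
  Congruent (_ ∷⟨ _ ⟩ _) [ _ ] = ⊥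
  Congruent (u ∷⟨ p ⟩ w) (u' ∷⟨ p' ⟩ w') =
    Independent (ends u _ p) (ends u' _ p') × Congruent w w'

  SamePart : V → V → Set
  SamePart (inj₁ _) (inj₁ _) = ⊤
  SamePart (inj₂ _) (inj₂ _) = ⊤
  SamePart (inj₁ _) (inj₂ _) = ⊥
  SamePart (inj₂ _) (inj₁ _) = ⊥

  InF : V × V → Set
  InF (a , b) = a ≢ b × SamePart a b

  _Γ_ : V × V → V × V → Set
  (a , b) Γ (f , g) =
    InF (a , b) × InF (f , g) ×
    Σ (Walk a f) (λ w → Σ (Walk b g) (λ w' → Congruent w w'))

  -- (a,b) is relevant: its implication class contains two distinct pairs
  Relevant : V × V → Set
  Relevant p =
    InF p × ∃ λ q → ∃ λ r → q ≢ r × p Γ q × p Γ r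

module Submission where

-- For X-pairs everything can be read off the 2×2 adjacency
-- pattern: congruent walks between X-pairs advance two edges at a time, and a
-- double step (p,q) → (p',q') through a Y-pair (y,z) exists exactly when both
-- (p,q) and (p',q') "see" (y,z), i.e. py, qz, p'y, q'z are edges and pz, qy,
-- p'z, q'y are not.  Call such X-pairs linked; Γ between X-pairs is then the
-- reflexive-transitive closure of this symmetric relation.
--
-- The heart is a local lemma
-- ('step'): if (p,q) is linked to (p',q') and c is separated from p, q, then
-- either (p,c) or (c,q) is already linked to (p,q), or the chain can advance
-- to (p',c) and (c,q').  Following the chain from (a,b) to (c,d) ('chase'), the
-- second alternative cannot persist to the end, since the last pair has c as
-- its first vertex; so (a,c) or (c,b) gets linked to (a,b), which gives Γ.

open import Defs
open import Data.Nat using (ℕ)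
open import Data.Fin using (Fin)
open import Data.Bool using (Bool; T)
open import Data.Sum using (_⊎_; inj₁; inj₂)
import Data.Sum as Sum
open import Data.Product using (_×_; _,_; Σ; ∃; ∃₂; proj₂)
open import Data.Unit using (tt)
open import Data.Empty using (⊥-elim)
open import Function using (_∘_)
open import Relation.Binary.PropositionalEquality using (_≡_; _≢_; refl; sym; trans)
open import Relation.Binary.Construct.Closure.ReflexiveTransitive
  using (Star; ε; _◅_; _◅◅_; reverse)
open import Relation.Nullary using (¬_; yes; no)
open import Relation.Nullary.Decidable.Core using (T?)

module Theory {m n : ℕ} (E : Fin m → Fin n → Bool) where
  open Graph E

  CongruentWalks : V → V → V → V → Set
  CongruentWalks u v f g = Σ (Walk u f) λ w → Σ (Walk v g) λ w' → Congruent w w'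

  inF : {p q : Fin m} → p ≢ q → InF (inj₁ p , inj₁ q)
  inF p≢q = (λ { refl → p≢q refl }) , tt

  -- Rows p,q and columns y,z of the adjacency matrix form the identity
  -- pattern; equivalently, py and qz are independent edges.
  Sees : Fin m → Fin m → Fin n → Fin n → Set
  Sees p q y z = T (E p y) × ¬ T (E p z) × ¬ T (E q y) × T (E q z)

  sees-distinct : {p q : Fin m} {y z : Fin n} → Sees p q y z → p ≢ q
  sees-distinct (py , _ , ¬qy , _) refl = ¬qy py

  sees-independent : {p q : Fin m} {y z : Fin n} → Sees p q y z → Independent (p , y) (q , z)
  sees-independent s@(py , ¬pz , ¬qy , _) = sees-distinct s , (λ { refl → ¬pz py }) , ¬pz , ¬qy

  independent-sees : {p q : Fin m} {y z : Fin n} →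
                     T (E p y) → T (E q z) → Independent (p , y) (q , z) → Sees p q y z
  independent-sees py qz (_ , _ , ¬pz , ¬qy) = py , ¬pz , ¬qy , qz

  XPair : Set
  XPair = Fin m × Fin m

  -- An X-pair is active when it admits a first congruent step.
  Active : XPair → Set
  Active (p , q) = ∃₂ λ y z → Sees p q y z

  Linked : XPair → XPair → Set
  Linked (p , q) (p' , q') = ∃₂ λ y z → Sees p q y z × Sees p' q' y z

  -- Chains of linked pairs; Linked* is an equivalence since Linked is symmetric.
  Linked* : XPair → XPair → Set
  Linked* = Star Linked

  shared : {p q p' q' : Fin m} {y z : Fin n} → Sees p q y z → Sees p' q' y z → Linked (p , q) (p' , q')
  shared s s' = _ , _ , s , s'

  linked-flip : {x x' : XPair} → Linked x x' → Linked x' x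
  linked-flip (y , z , s , s') = y , z , s' , s

  linked-active : {x x' : XPair} → Linked x x' → Active x'
  linked-active (y , z , _ , s') = y , z , s'

  linked-distinct : {x : XPair} {p' q' : Fin m} → Linked x (p' , q') → p' ≢ q'
  linked-distinct (_ , _ , _ , s') = sees-distinct s'

  active-along : {x x' : XPair} → Active x → Linked* x x' → Active x'
  active-along act ε = act
  active-along _ (l ◅ ls) = active-along (linked-active l) ls

  linked*-walks : {p q p' q' : Fin m} → Linked* (p , q) (p' , q') →
                  CongruentWalks (inj₁ p) (inj₁ q) (inj₁ p') (inj₁ q')
  linked*-walks {p} {q} ε = [ inj₁ p ] , [ inj₁ q ] , tt
  linked*-walks {p} {q} ((y , z , s@(py , _ , _ , qz) , s'@(p'y , _ , _ , q'z)) ◅ ls)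
    with linked*-walks ls
  ... | w , w' , c = (inj₁ p ∷⟨ py ⟩ (inj₂ y ∷⟨ p'y ⟩ w))
                   , (inj₁ q ∷⟨ qz ⟩ (inj₂ z ∷⟨ q'z ⟩ w'))
                   , sees-independent s , sees-independent s' , c

  linked*Γ : {p q p' q' : Fin m} → p ≢ q → p' ≢ q' → Linked* (p , q) (p' , q') →
             (inj₁ p , inj₁ q) Γ (inj₁ p' , inj₁ q')
  linked*Γ p≢q p'≢q' ls = inF p≢q , inF p'≢q' , linked*-walks ls

  walks-linked* : {p q f : Fin m} {g : V} (w : Walk (inj₁ p) (inj₁ f)) (w' : Walk (inj₁ q) g) →
                  Congruent w w' → ∃ λ r → Linked* (p , q) (f , r)
  walks-linked* [ _ ] [ _ ] _ = _ , ε
  walks-linked* [ _ ] (_ ∷⟨ _ ⟩ _) ()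
  walks-linked* (_ ∷⟨ _ ⟩ _) [ _ ] ()
  walks-linked* (_∷⟨_⟩_ _ {inj₁ _} () _) _ _
  walks-linked* (_∷⟨_⟩_ _ {inj₂ _} _ (_∷⟨_⟩_ _ {inj₂ _} () _)) _ _
  walks-linked* (_∷⟨_⟩_ _ {inj₂ _} _ (_ ∷⟨ _ ⟩ _)) (_∷⟨_⟩_ _ {inj₁ _} () _) _
  walks-linked* (_∷⟨_⟩_ _ {inj₂ _} _ (_ ∷⟨ _ ⟩ _)) (_∷⟨_⟩_ _ {inj₂ _} _ [ _ ]) (_ , ())
  walks-linked* (_∷⟨_⟩_ _ {inj₂ _} _ (_ ∷⟨ _ ⟩ _)) (_∷⟨_⟩_ _ {inj₂ _} _ (_∷⟨_⟩_ _ {inj₂ _} () _)) _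
  walks-linked* (_∷⟨_⟩_ _ {inj₂ y} py (_∷⟨_⟩_ _ {inj₁ p'} p'y w))
                (_∷⟨_⟩_ _ {inj₂ z} qz (_∷⟨_⟩_ _ {inj₁ q'} q'z w')) (i , i' , c)
    with walks-linked* w w' c
  ... | r , ls = r , shared (independent-sees py qz i) (independent-sees p'y q'z i') ◅ ls

  -- Congruent walks from an X-pair either stay put or start with a congruent
  -- step; a relevant pair therefore has to be active.
  first-step : {p q : Fin m} {f g : V} (w : Walk (inj₁ p) f) (w' : Walk (inj₁ q) g) →
               Congruent w w' → Active (p , q) ⊎ (f , g) ≡ (inj₁ p , inj₁ q)
  first-step [ _ ] [ _ ] _ = inj₂ refl
  first-step [ _ ] (_ ∷⟨ _ ⟩ _) ()
  first-step (_ ∷⟨ _ ⟩ _) [ _ ] ()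
  first-step (_∷⟨_⟩_ _ {inj₁ _} () _) _ _
  first-step (_∷⟨_⟩_ _ {inj₂ _} _ _) (_∷⟨_⟩_ _ {inj₁ _} () _) _
  first-step (_∷⟨_⟩_ _ {inj₂ y} py _) (_∷⟨_⟩_ _ {inj₂ z} qz _) (i , _) =
    inj₁ (y , z , independent-sees py qz i)

  relevant-active : {p q : Fin m} → Relevant (inj₁ p , inj₁ q) → Active (p , q)
  relevant-active (_ , _ , _ , f≢g , (_ , _ , w , w' , c) , (_ , _ , x , x' , d))
    with first-step w w' c | first-step x x' d
  ... | inj₁ act | _ = act
  ... | inj₂ _ | inj₁ act = act
  ... | inj₂ e | inj₂ e' = ⊥-elim (f≢g (trans e (sym e')))

  Separated : Fin m → Fin m → Fin m → Set
  Separated c p q = (∃ λ t → T (E c t) × (¬ T (E p t) ⊎ ¬ T (E q t)))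
                  × (∃ λ s → ¬ T (E c s) × (T (E p s) ⊎ T (E q s)))

  separated : {c p q : Fin m} → Active (p , c) ⊎ Active (c , q) → Separated c p q
  separated (inj₁ (s , t , ps , ¬pt , ¬cs , ct)) = (t , ct , inj₁ ¬pt) , (s , ¬cs , inj₁ ps)
  separated (inj₂ (t , u , ct , ¬cu , ¬qt , qu)) = (t , ct , inj₂ ¬qt) , (u , ¬cu , inj₂ qu)

  data Outcome (c p q p' q' : Fin m) : Set where
    escape-left  : Linked* (p , c) (p , q) → Outcome c p q p' q'
    escape-right : Linked* (c , q) (p , q) → Outcome c p q p' q'
    advance      : Linked (p , c) (p' , c) → Linked (c , q) (c , q') → Outcome c p q p' q'

  -- The local lemma when c is adjacent to neither y nor z: the neighbour t of
  -- c decides, together with the adjacencies of p' and q' to t.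
  step-missing : {c p q p' q' : Fin m} {y z : Fin n} → Sees p q y z → Sees p' q' y z →
                 ¬ T (E c y) → ¬ T (E c z) → (∃ λ t → T (E c t) × (¬ T (E p t) ⊎ ¬ T (E q t))) →
                 Outcome c p q p' q'
  step-missing {p = p} {q} {p'} {q'} X@(py , ¬pz , ¬qy , qz) X'@(p'y , ¬p'z , ¬q'y , q'z) ¬cy ¬cz (t , ct , miss)
    with T? (E p t) | T? (E q t)
  ... | yes pt | yes qt = ⊥-elim (Sum.[ (λ ¬pt → ¬pt pt) , (λ ¬qt → ¬qt qt) ] miss)
  ... | no ¬pt | yes qt = escape-left (shared (py , ¬pt , ¬cy , ct) (py , ¬pt , ¬qy , qt) ◅ ε)
  ... | yes pt | no ¬qt = escape-right (shared (ct , ¬cz , ¬qt , qz) (pt , ¬pz , ¬qt , qz) ◅ ε)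
  ... | no ¬pt | no ¬qt with T? (E p' t) | T? (E q' t)
  ...   | no ¬p't | no ¬q't =
          advance (shared (py , ¬pt , ¬cy , ct) (p'y , ¬p't , ¬cy , ct))
                  (shared (ct , ¬cz , ¬qt , qz) (ct , ¬cz , ¬q't , q'z))
  ...   | no ¬p't | yes q't =
          escape-left (shared (py , ¬pt , ¬cy , ct) (p'y , ¬p't , ¬q'y , q't) ◅ shared X' X ◅ ε)
  ...   | yes p't | no ¬q't =
          escape-right (shared (ct , ¬cz , ¬qt , qz) (p't , ¬p'z , ¬q't , q'z) ◅ shared X' X ◅ ε)
  ...   | yes p't | yes q't =
          escape-left (shared (py , ¬pt , ¬cy , ct) (py , ¬pt , ¬q'y , q't)
                       ◅ shared (py , ¬pz , ¬q'y , q'z) X ◅ ε)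

  -- The local lemma when c is adjacent to both y and z: now the
  -- non-neighbour s of c decides.
  step-hitting : {c p q p' q' : Fin m} {y z : Fin n} → Sees p q y z → Sees p' q' y z →
                 T (E c y) → T (E c z) → (∃ λ s → ¬ T (E c s) × (T (E p s) ⊎ T (E q s))) →
                 Outcome c p q p' q'
  step-hitting {p = p} {q} {p'} {q'} X@(py , ¬pz , ¬qy , qz) (p'y , ¬p'z , ¬q'y , q'z) cy cz (s , ¬cs , hit)
    with T? (E p s) | T? (E q s)
  ... | no ¬ps | no ¬qs = ⊥-elim (Sum.[ ¬ps , ¬qs ] hit)
  ... | yes ps | no ¬qs = escape-left (shared (ps , ¬pz , ¬cs , cz) (ps , ¬pz , ¬qs , qz) ◅ ε)
  ... | no ¬ps | yes qs = escape-right (shared (cy , ¬cs , ¬qy , qs) (py , ¬ps , ¬qy , qs) ◅ ε)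
  ... | yes ps | yes qs with T? (E p' s) | T? (E q' s)
  ...   | yes p's | yes q's =
          advance (shared (ps , ¬pz , ¬cs , cz) (p's , ¬p'z , ¬cs , cz))
                  (shared (cy , ¬cs , ¬qy , qs) (cy , ¬cs , ¬q'y , q's))
  ...   | no ¬p's | _ =
          escape-right (shared (cy , ¬cs , ¬qy , qs) (p'y , ¬p's , ¬qy , qs)
                        ◅ shared (p'y , ¬p'z , ¬qy , qz) X ◅ ε)
  ...   | yes p's | no ¬q's =
          escape-left (shared (ps , ¬pz , ¬cs , cz) (ps , ¬pz , ¬q's , q'z)
                       ◅ shared (py , ¬pz , ¬q'y , q'z) X ◅ ε)

  -- The local lemma: if c sees exactly one of y, z it replaces p or q
  -- directly; otherwise one of the two cases above applies.
  step : {c p q p' q' : Fin m} {y z : Fin n} → Sees p q y z → Sees p' q' y z →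
         Separated c p q → Outcome c p q p' q'
  step {c} {y = y} {z} X@(py , ¬pz , ¬qy , qz) X' (missing , hitting) with T? (E c y) | T? (E c z)
  ... | yes cy | no ¬cz = escape-right (shared (cy , ¬cz , ¬qy , qz) X ◅ ε)
  ... | no ¬cy | yes cz = escape-left (shared (py , ¬pz , ¬cy , cz) X ◅ ε)
  ... | no ¬cy | no ¬cz = step-missing X X' ¬cy ¬cz missing
  ... | yes cy | yes cz = step-hitting X X' cy cz hitting

  -- Walk along a chain from (p,q) to a pair with first vertex c, keeping
  -- (p,q), (p,c), (c,q) linked to (a,b), (a,c), (c,b) respectively; the chain
  -- cannot end while p ≢ c, so some step must escape.
  chase : {a b c p q r : Fin m} → Active (a , c) ⊎ Active (c , b) →
          Linked* (a , b) (p , q) → Linked* (a , c) (p , c) → Linked* (c , b) (c , q) → p ≢ c →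
          Linked* (p , q) (c , r) → Linked* (a , c) (a , b) ⊎ Linked* (c , b) (a , b)
  chase _ _ _ _ p≢c ε = ⊥-elim (p≢c refl)
  chase act ab ac cb _ (l@(_ , _ , X , X') ◅ rest)
    with step X X' (separated (Sum.map (λ act-ac → active-along act-ac ac) (λ act-cb → active-along act-cb cb) act))
  ... | escape-left e = inj₁ (ac ◅◅ e ◅◅ reverse linked-flip ab)
  ... | escape-right e = inj₂ (cb ◅◅ e ◅◅ reverse linked-flip ab)
  ... | advance lc lq =
        chase act (ab ◅◅ l ◅ ε) (ac ◅◅ lc ◅ ε) (cb ◅◅ lq ◅ ε) (linked-distinct lc) rest

corollary3p4 : {m n : ℕ} (E : Fin m → Fin n → Bool) (a b c d : Fin m) →
    a ≢ b → a ≢ c → b ≢ c → c ≢ d →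
    Graph._Γ_ E (inj₁ a , inj₁ b) (inj₁ c , inj₁ d) →
    (Graph.Relevant E (inj₁ a , inj₁ c) ⊎ Graph.Relevant E (inj₁ c , inj₁ b)) →
    Graph._Γ_ E (inj₁ a , inj₁ c) (inj₁ a , inj₁ b) ⊎ Graph._Γ_ E (inj₁ c , inj₁ b) (inj₁ a , inj₁ b)
corollary3p4 E a b c d a≢b a≢c b≢c _ (_ , _ , w , w' , congruent) relevant =
  Sum.map (linked*Γ a≢c a≢b) (linked*Γ (b≢c ∘ sym) a≢b)
          (chase (Sum.map relevant-active relevant-active relevant) ε ε ε a≢c
                 (proj₂ (walks-linked* w w' congruent)))
  where open Theory E
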